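{- Let $n,a\in\mathbb{N}$. Then $\operatorname{ord}_n^{(k)}(a)$ divides $\lambda^{(k)}(n)$ for every $k\in\mathbb{N}_0$, and consequently $L_a(n)$ divides $L(n)$.
   Context: $\lambda$ is Carmichael's function ($\lambda(n)$ is the exponent of $\mathbb{Z}_n^*$), $\lambda^{(0)}(n)=n$, $\lambda^{(k)}=\lambda\circ\lambda^{(k-1)}$, $H(n)=\min\{\alpha:\lambda^{(\alpha)}(n)=1\}$, $L(n)=\operatorname{lcm}\{n,\lambda(n),\dots,\lambda^{(H(n))}(n)\}$. For $n,a\in\mathbb{N}$, $V(a,n)$ is the largest divisor of $n$ coprime to $a$. Iterated orders: $\operatorname{ord}_n^{(0)}(a)=n$ and $\operatorname{ord}_n^{(k)}(a)=\operatorname{ord}_{V(a,\operatorname{ord}_n^{(k-1)}(a))}(a)$ for $k\in\mathbb{N}$, where $\operatorname{ord}_m(a)$ is the multiplicative order of $a$ modulo $m$ (with $\operatorname{ord}_1(a)=1$). $L_a(n)$ is the least common multiple of all $\operatorname{ord}_n^{(i)}(a)$, $i\ge0$. -}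

module Defs where

open import Data.Nat.Base using (ℕ; zero; suc; _+_; _∸_; _^_; _%_; _≡ᵇ_)
open import Data.Bool.Base using (Bool; true; false; if_then_else_; _∧_)
open import Data.Nat.GCD using (gcd)
open import Data.Nat.LCM using (lcm)
open import Data.Nat.Divisibility using (_∣?_)
open import Relation.Nullary.Decidable using (⌊_⌋)

-- Boolean congruence  x ≡ y (mod n)  (for n = 0: equality in ℤ, i.e. in ℕ)
congᵇ : ℕ → ℕ → ℕ → Bool
congᵇ x y zero    = x ≡ᵇ y
congᵇ x y (suc k) = (x % suc k) ≡ᵇ (y % suc k)

allBelow : ℕ → (ℕ → Bool) → Bool
allBelow zero    p = true
allBelow (suc n) p = allBelow n p ∧ p n

searchFrom : (ℕ → Bool) → ℕ → ℕ → ℕ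
searchFrom p s zero       = 0
searchFrom p s (suc fuel) = if p s then s else searchFrom p (suc s) fuel

-- least k ∈ {1..b} with p k (0 if none)
leastPos : (ℕ → Bool) → ℕ → ℕ
leastPos p b = searchFrom p 1 b

largestUpTo : (ℕ → Bool) → ℕ → ℕ
largestUpTo p zero    = 0
largestUpTo p (suc n) = if p (suc n) then suc n else largestUpTo p n

coprimeᵇ : ℕ → ℕ → Bool
coprimeᵇ x y = gcd x y ≡ᵇ 1

-- m is an exponent of Z_n^* : x^m ≡ 1 (mod n) for all x ∈ {0..n-1} coprime to n
isExponentᵇ : ℕ → ℕ → Bool
isExponentᵇ n m = allBelow n (λ x → if coprimeᵇ x n then congᵇ (x ^ m) 1 n else true)

-- Carmichael's function: least positive exponent of Z_n^*
-- (it divides φ(n) ≤ n, so searching in {1..n} suffices for n ≥ 1)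
carmichael : ℕ → ℕ
carmichael n = leastPos (isExponentᵇ n) n

-- multiplicative order of a modulo m: least k ≥ 1 with a^k ≡ 1 (mod m)
-- (ord_1(a) = 1; for gcd(a,m)=1 the order is ≤ φ(m) ≤ m)
ord : ℕ → ℕ → ℕ
ord m a = leastPos (λ k → congᵇ (a ^ k) 1 m) m

V : ℕ → ℕ → ℕ
V a n = largestUpTo (λ d → ⌊ d ∣? n ⌋ ∧ coprimeᵇ d a) n

iter : (ℕ → ℕ) → ℕ → ℕ → ℕ
iter f zero    x = x
iter f (suc k) x = f (iter f k x)

carmichaelIter : ℕ → ℕ → ℕ
carmichaelIter k n = iter carmichael k n

ordIter : ℕ → ℕ → ℕ → ℕ
ordIter zero    n a = n
ordIter (suc k) n a = ord (V a (ordIter k n a)) a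

lcmUpTo : (ℕ → ℕ) → ℕ → ℕ
lcmUpTo f zero    = f 0
lcmUpTo f (suc m) = lcm (lcmUpTo f m) (f (suc m))

-- H(n) = min { α : λ^{(α)}(n) = 1 }  (α ≤ n suffices, since λ(m) < m for m ≥ 2)
H : ℕ → ℕ
H n = searchFrom (λ α → carmichaelIter α n ≡ᵇ 1) 0 (suc n)

L : ℕ → ℕ
L n = lcmUpTo (λ i → carmichaelIter i n) (H n)

-- L_a(n) = lcm of all ord_n^{(i)}(a), i ≥ 0.  For n ≥ 1 the sequence strictly
-- decreases until it reaches 1 and then stays 1, so the indices i ≤ n suffice.
La : ℕ → ℕ → ℕ
La a n = lcmUpTo (λ i → ordIter i n a) n

{-# OPTIONS --safe #-}
-- If d ∣ c, every residue x coprime to d lifts to a residue y ≡ x (mod d) coprime to c, so every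
-- exponent of ℤ_c^* is an exponent of ℤ_d^*.  Now V(a, ord⁽ᵏ⁾) divides ord⁽ᵏ⁾, which by induction
-- divides λ⁽ᵏ⁾(n), and it is coprime to a; hence a^λ⁽ᵏ⁺¹⁾(n) ≡ 1 modulo V(a, ord⁽ᵏ⁾), that is
-- ord⁽ᵏ⁺¹⁾ ∣ λ⁽ᵏ⁺¹⁾(n).  From H(n) on the iterates λ⁽ⁱ⁾(n) are 1, so each ord⁽ⁱ⁾ divides a term
-- of L(n).  Euler's theorem supplies a positive exponent φ(m) ≤ m, which is what makes the bounded
-- searches defining λ and ord return least positive solutions.

module Submission where

open import Defs
open import Data.Bool.Base using (Bool; true; false; T; if_then_else_; _∧_)
open import Data.Bool.Properties using (T-∧)
open import Data.Empty using (⊥-elim)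
open import Data.List.Base using (List; []; _∷_; map; filter; upTo; length)
open import Data.List.Membership.Propositional using (_∈_; lose)
open import Data.List.Membership.Propositional.Properties
  using (∈-filter⁻; ∈-filter⁺; ∈-upTo⁻; ∈-upTo⁺; ∈-map⁺; ∈-map⁻; ∈-length)
open import Data.List.Membership.Propositional.Properties.WithK using (unique∧set⇒bag)
open import Data.List.Properties using (length-filter; length-upTo; filter-notAll)
open import Data.List.Relation.Binary.BagAndSetEquality using (∼bag⇒↭)
open import Data.List.Relation.Binary.Permutation.Propositional using (_↭_)
open import Data.List.Relation.Unary.All using (All; []; _∷_; tabulate)
open import Data.List.Relation.Unary.AllPairs as AllPairs using (AllPairs)
import Data.List.Relation.Unary.AllPairs.Properties as AllPairsₚ
open import Data.Nat.Base
open import Data.Nat.Coprimality as Coprimality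
  using (Coprime; coprime?; coprime-Bézout; coprime-divisor; gcd≡1⇒coprime; coprime⇒gcd≡1; 1-coprimeTo)
open import Data.Nat.Divisibility
open import Data.Nat.DivMod
open import Data.Nat.GCD using (gcd; gcd[m,n]∣m; gcd[m,n]∣n; module Bézout)
open import Data.Nat.Induction using (<-wellFounded)
open import Data.Nat.LCM using (lcm-least; m∣lcm[m,n]; n∣lcm[m,n])
open import Data.Nat.ListAction using (product)
open import Data.Nat.ListAction.Properties using (product-↭)
open import Data.Nat.Properties
open import Data.Nat.Solver using (module +-*-Solver)
open import Data.Product using (_×_; _,_; proj₁; proj₂; ∃; ∃₂)
open import Data.Sum using (_⊎_; inj₁; inj₂)
open import Data.Unit using (tt)
open import Function.Base using (_∘_)
open import Function.Bundles using (_⇔_; mk⇔; Equivalence)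
open import Induction.WellFounded using (Acc; acc)
open import Relation.Binary.PropositionalEquality
open import Relation.Nullary using (¬_; yes; no; contradiction)
open import Relation.Nullary.Decidable using (toWitness; fromWitness)

open Equivalence using (to; from)

T-if-else-true : ∀ {b c} → T (if b then c else true) ⇔ (T b → T c)
T-if-else-true {true}  = mk⇔ (λ t _ → t) (λ f → f tt)
T-if-else-true {false} = mk⇔ (λ _ ()) (λ _ → tt)

allBelow⇔ : ∀ n p → T (allBelow n p) ⇔ (∀ x → x < n → T (p x))
allBelow⇔ zero    p = mk⇔ (λ _ _ ()) (λ _ → tt)
allBelow⇔ (suc n) p = mk⇔ below below⁻¹
  where
  below : T (allBelow n p ∧ p n) → ∀ x → x < suc n → T (p x)
  below t x x<1+n with m<1+n⇒m<n∨m≡n x<1+n | to T-∧ t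
  ... | inj₁ x<n  | t₁ , _  = to (allBelow⇔ n p) t₁ x x<n
  ... | inj₂ refl | _  , t₂ = t₂

  below⁻¹ : (∀ x → x < suc n → T (p x)) → T (allBelow n p ∧ p n)
  below⁻¹ h = from T-∧ (from (allBelow⇔ n p) (λ x x<n → h x (m<n⇒m<1+n x<n)) , h n ≤-refl)

coprimeᵇ⇔ : ∀ x y → T (coprimeᵇ x y) ⇔ Coprime x y
coprimeᵇ⇔ x y = mk⇔ (gcd≡1⇒coprime ∘ ≡ᵇ⇒≡ (gcd x y) 1) (≡⇒≡ᵇ (gcd x y) 1 ∘ coprime⇒gcd≡1)

congᵇ⇔ : ∀ x y m .{{_ : NonZero m}} → T (congᵇ x y m) ⇔ (x % m ≡ y % m)
congᵇ⇔ x y (suc k) = mk⇔ (≡ᵇ⇒≡ (x % suc k) (y % suc k)) (≡⇒≡ᵇ (x % suc k) (y % suc k))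

record FirstHit (p : ℕ → Bool) (s c r : ℕ) : Set where
  field
    start≤  : s ≤ r
    bounded : r ≤ c
    hit     : T (p r)
    first   : ∀ {j} → s ≤ j → j < r → ¬ T (p j)

searchFrom-firstHit : ∀ p s f {c} → s ≤ c → c < s + f → T (p c) →
                      FirstHit p s c (searchFrom p s f)
searchFrom-firstHit p s zero s≤c c<s+0 _ =
  ⊥-elim (<⇒≱ (subst (_ <_) (+-identityʳ s) c<s+0) s≤c)
searchFrom-firstHit p s (suc f) s≤c c<s+f pc with p s in ps
... | true = record
  { start≤ = ≤-refl ; bounded = s≤c ; hit = subst T (sym ps) tt
  ; first = λ s≤j j<s → ⊥-elim (<⇒≱ j<s s≤j) }
... | false with m≤n⇒m<n∨m≡n s≤c
...   | inj₂ refl = ⊥-elim (subst T ps pc)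
...   | inj₁ s<c = record
  { start≤ = <⇒≤ (FirstHit.start≤ rest) ; bounded = FirstHit.bounded rest
  ; hit = FirstHit.hit rest ; first = first }
  where
  rest = searchFrom-firstHit p (suc s) f s<c (≤-trans c<s+f (≤-reflexive (+-suc s f))) pc

  first : ∀ {j} → s ≤ j → j < searchFrom p (suc s) f → ¬ T (p j)
  first s≤j j<r with m≤n⇒m<n∨m≡n s≤j
  ... | inj₂ refl = subst T ps
  ... | inj₁ s<j  = FirstHit.first rest s<j j<r

largestUpTo-positive : ∀ p n → 1 ≤ n → T (p 1) → 1 ≤ largestUpTo p n × T (p (largestUpTo p n))
largestUpTo-positive p (suc n) _ p1 with p (suc n) in pn
... | true = s≤s z≤n , subst T (sym pn) tt
... | false with n
...   | zero   = ⊥-elim (subst T pn p1)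
...   | suc n′ = largestUpTo-positive p (suc n′) (s≤s z≤n) p1

least-positive-∣ : (P : ℕ → Set) (o : ℕ) .{{_ : NonZero o}} →
                   (∀ {j} → 1 ≤ j → j < o → ¬ P j) → (∀ {e} → P e → P (e % o)) →
                   ∀ {e} → P e → o ∣ e
least-positive-∣ P o minimal closed {e} pe with e % o in e%o
... | zero  = m%n≡0⇒n∣m e o e%o
... | suc r = ⊥-elim (minimal (s≤s z≤n) (subst (_< o) e%o (m%n<n e o)) (subst P e%o (closed pe)))

module _ (m : ℕ) .{{_ : NonZero m}} where

  %-cong-* : ∀ {a b c d} → a % m ≡ b % m → c % m ≡ d % m → (a * c) % m ≡ (b * d) % m
  %-cong-* {a} {b} {c} {d} a≡b c≡d = begin
    (a * c) % m             ≡⟨ %-distribˡ-* a c m ⟩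
    ((a % m) * (c % m)) % m ≡⟨ cong₂ (λ x y → (x * y) % m) a≡b c≡d ⟩
    ((b % m) * (d % m)) % m ≡⟨ %-distribˡ-* b d m ⟨
    (b * d) % m             ∎
    where open ≡-Reasoning

  %-cong-^ : ∀ {a b} e → a % m ≡ b % m → (a ^ e) % m ≡ (b ^ e) % m
  %-cong-^ zero    _   = refl
  %-cong-^ (suc e) a≡b = %-cong-* a≡b (%-cong-^ e a≡b)

  ^≡1⇒^[%]≡1 : ∀ x o e .{{_ : NonZero o}} → (x ^ o) % m ≡ 1 % m → (x ^ e) % m ≡ 1 % m →
               (x ^ (e % o)) % m ≡ 1 % m
  ^≡1⇒^[%]≡1 x o e xᵒ≡1 xᵉ≡1 = begin
    (x ^ r) % m               ≡⟨ cong (_% m) (*-identityʳ (x ^ r)) ⟨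
    (x ^ r * 1) % m           ≡⟨ cong (λ t → (x ^ r * t) % m) (^-zeroˡ q) ⟨
    (x ^ r * 1 ^ q) % m       ≡⟨ %-cong-* {x ^ r} refl (%-cong-^ q xᵒ≡1) ⟨
    (x ^ r * (x ^ o) ^ q) % m ≡⟨ cong (_% m) xᵉ≡xʳ*[xᵒ]^q ⟨
    (x ^ e) % m               ≡⟨ xᵉ≡1 ⟩
    1 % m                     ∎
    where
    open ≡-Reasoning
    r = e % o
    q = e / o
    xᵉ≡xʳ*[xᵒ]^q : x ^ e ≡ x ^ r * (x ^ o) ^ q
    xᵉ≡xʳ*[xᵒ]^q = begin
      x ^ e               ≡⟨ cong (x ^_) (m≡m%n+[m/n]*n e o) ⟩
      x ^ (r + q * o)     ≡⟨ ^-distribˡ-+-* x r (q * o) ⟩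
      x ^ r * x ^ (q * o) ≡⟨ cong (λ t → x ^ r * x ^ t) (*-comm q o) ⟩
      x ^ r * x ^ (o * q) ≡⟨ cong (x ^ r *_) (^-*-assoc x o q) ⟨
      x ^ r * (x ^ o) ^ q ∎

  Invertible : ℕ → Set
  Invertible x = ∃ λ y → (x * y) % m ≡ 1 % m

  invertible⇒coprime : ∀ {x} → Invertible x → Coprime x m
  invertible⇒coprime {x} (y , xy≡1) (i∣x , i∣m) =
    ∣1⇒≡1 (∣n∣m%n⇒∣m i∣m (subst (_ ∣_) xy≡1 (%-presˡ-∣ (∣m⇒∣m*n y i∣x) i∣m)))

  invertible-* : ∀ {a b} → Invertible a → Invertible b → Invertible (a * b)
  invertible-* {a} {b} (a′ , aa′≡1) (b′ , bb′≡1) =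
    a′ * b′ , trans (cong (_% m) ([m*n]*[o*p]≡[m*o]*[n*p] a b a′ b′)) (%-cong-* aa′≡1 bb′≡1)

  invertible-cancelʳ : ∀ {a b c} → Invertible c → (a * c) % m ≡ (b * c) % m → a % m ≡ b % m
  invertible-cancelʳ {a} {b} {c} (c′ , cc′≡1) ac≡bc = begin
    a % m              ≡⟨ cancel a ⟨
    (a * c * c′) % m   ≡⟨ %-cong-* ac≡bc refl ⟩
    (b * c * c′) % m   ≡⟨ cancel b ⟩
    b % m              ∎
    where
    open ≡-Reasoning
    cancel : ∀ x → (x * c * c′) % m ≡ x % m
    cancel x = begin
      (x * c * c′) % m   ≡⟨ cong (_% m) (*-assoc x c c′) ⟩
      (x * (c * c′)) % m ≡⟨ %-cong-* {x} refl cc′≡1 ⟩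
      (x * 1) % m        ≡⟨ cong (_% m) (*-identityʳ x) ⟩
      x % m              ∎

  coprime-% : ∀ {x} → Coprime x m → Coprime (x % m) m
  coprime-% x⊥m (i∣x%m , i∣m) = x⊥m (∣n∣m%n⇒∣m i∣m i∣x%m , i∣m)

coprime⇒invertible : ∀ {x} m .{{_ : NonZero m}} → Coprime x m → Invertible m x
coprime⇒invertible {x} m@(suc k) x⊥m with coprime-Bézout x⊥m
... | Bézout.+- a b 1+bm≡ax = a , (begin
  (x * a) % m     ≡⟨ cong (_% m) (trans (*-comm x a) (sym 1+bm≡ax)) ⟩
  (1 + b * m) % m ≡⟨ [m+kn]%n≡m%n 1 b m ⟩
  1 % m           ∎)
  where open ≡-Reasoning
-- Here a x ≡ -1 (mod m), so (m - 1) a = k a is an inverse of x.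
... | Bézout.-+ a b 1+ax≡bm = k * a , (begin
  (x * (k * a)) % m         ≡⟨ [m+kn]%n≡m%n (x * (k * a)) 1 m ⟨
  (x * (k * a) + 1 * m) % m ≡⟨ cong (_% m) (solve 3 (λ x k a → x :* (k :* a) :+ con 1 :* (con 1 :+ k) := k :* (con 1 :+ a :* x) :+ con 1) refl x k a) ⟩
  (k * (1 + a * x) + 1) % m ≡⟨ cong (λ t → (k * t + 1) % m) 1+ax≡bm ⟩
  (k * (b * m) + 1) % m     ≡⟨ cong (_% m) (trans (+-comm (k * (b * m)) 1) (cong (1 +_) (sym (*-assoc k b m)))) ⟩
  (1 + k * b * m) % m       ≡⟨ [m+kn]%n≡m%n 1 (k * b) m ⟩
  1 % m                     ∎)
  where
  open ≡-Reasoning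
  open +-*-Solver

coprime-* : ∀ {x y} m .{{_ : NonZero m}} → Coprime x m → Coprime y m → Coprime (x * y) m
coprime-* {x} {y} m x⊥m y⊥m = invertible⇒coprime m (invertible-* m {x} {y} (coprime⇒invertible m x⊥m) (coprime⇒invertible m y⊥m))

coprime-product : ∀ {us} m .{{_ : NonZero m}} → All (λ u → Coprime u m) us → Coprime (product us) m
coprime-product m []           = 1-coprimeTo m
coprime-product m (u⊥m ∷ us⊥m) = coprime-* m u⊥m (coprime-product m us⊥m)

module _ (m : ℕ) .{{_ : NonZero m}} where

  units : List ℕ
  units = filter (λ u → coprime? u m) (upTo m)

  totient : ℕ
  totient = length units

  ∈-units⁻ : ∀ {u} → u ∈ units → u < m × Coprime u m
  ∈-units⁻ u∈ with u∈upTo , u⊥m ← ∈-filter⁻ (λ u → coprime? u m) {xs = upTo m} u∈ = ∈-upTo⁻ u∈upTo , u⊥m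

  ∈-units⁺ : ∀ {u} → u < m → Coprime u m → u ∈ units
  ∈-units⁺ u<m u⊥m = ∈-filter⁺ (λ u → coprime? u m) (∈-upTo⁺ u<m) u⊥m

  -- Phrased with residues since u ↦ x u % m is injective only modulo m.
  units-residues-distinct : AllPairs (λ u v → u % m ≢ v % m) units
  units-residues-distinct = AllPairsₚ.filter⁺ (λ u → coprime? u m)
    (AllPairsₚ.applyUpTo⁺₁ (λ i → i) m (λ {i} {j} i<j j<m →
      subst₂ _≢_ (sym (m<n⇒m%n≡m (<-trans i<j j<m))) (sym (m<n⇒m%n≡m j<m)) (<⇒≢ i<j)))

  totient≤ : totient ≤ m
  totient≤ = ≤-trans (length-filter (λ u → coprime? u m) (upTo m)) (≤-reflexive (length-upTo m))

  totient≥1 : 1 ≤ totient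
  totient≥1 = ∈-length (∈-units⁺ (m%n<n 1 m) (coprime-% m (1-coprimeTo m)))

  totient< : 1 < m → totient < m
  totient< 1<m = ≤-trans (filter-notAll (λ u → coprime? u m) (upTo m) (lose (∈-upTo⁺ (>-nonZero⁻¹ m)) ¬0⊥m))
                         (≤-reflexive (length-upTo m))
    where
    ¬0⊥m : ¬ Coprime 0 m
    ¬0⊥m 0⊥m = >⇒≢ 1<m (0⊥m (m ∣0 , ∣-refl))

  module _ (x : ℕ) where

    scale : ℕ → ℕ
    scale u = (x * u) % m

    product-map-scale : ∀ us → product (map scale us) % m ≡ (x ^ length us * product us) % m
    product-map-scale []       = refl
    product-map-scale (u ∷ us) = begin
      (scale u * product (map scale us)) % m       ≡⟨ %-cong-* m (m%n%n≡m%n (x * u) m) (product-map-scale us) ⟩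
      ((x * u) * (x ^ length us * product us)) % m ≡⟨ cong (_% m) ([m*n]*[o*p]≡[m*o]*[n*p] x u (x ^ length us) (product us)) ⟩
      (x ^ length (u ∷ us) * product (u ∷ us)) % m ∎
      where open ≡-Reasoning

  module _ {x} (x⊥m : Coprime x m) where

    scale-preserves-units : ∀ {u} → u ∈ units → scale x u ∈ units
    scale-preserves-units u∈ = ∈-units⁺ (m%n<n _ m) (coprime-% m (coprime-* m x⊥m (proj₂ (∈-units⁻ u∈))))

    units⊆map-scale : ∀ {z} → z ∈ units → z ∈ map (scale x) units
    units⊆map-scale {z} z∈ with x′ , xx′≡1 ← coprime⇒invertible m x⊥m =
      subst (_∈ map (scale x) units) scale-u≡z (∈-map⁺ (scale x) u∈)
      where
      open ≡-Reasoning
      u = (x′ * z) % m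
      x′⊥m : Coprime x′ m
      x′⊥m = invertible⇒coprime m (x , trans (cong (_% m) (*-comm x′ x)) xx′≡1)
      u∈ : u ∈ units
      u∈ = ∈-units⁺ (m%n<n _ m) (coprime-% m (coprime-* m x′⊥m (proj₂ (∈-units⁻ z∈))))
      scale-u≡z : scale x u ≡ z
      scale-u≡z = begin
        (x * ((x′ * z) % m)) % m ≡⟨ %-cong-* m {x} refl (m%n%n≡m%n (x′ * z) m) ⟩
        (x * (x′ * z)) % m       ≡⟨ cong (_% m) (*-assoc x x′ z) ⟨
        (x * x′ * z) % m         ≡⟨ %-cong-* m xx′≡1 refl ⟩
        (1 * z) % m              ≡⟨ cong (_% m) (*-identityˡ z) ⟩
        z % m                    ≡⟨ m<n⇒m%n≡m (proj₁ (∈-units⁻ z∈)) ⟩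
        z                        ∎

    scale-residue-injective : ∀ {u v} → scale x u ≡ scale x v → u % m ≡ v % m
    scale-residue-injective {u} {v} eq = invertible-cancelʳ m (coprime⇒invertible m x⊥m)
      (trans (cong (_% m) (*-comm u x)) (trans eq (cong (_% m) (*-comm x v))))

    scale-permutes-units : map (scale x) units ↭ units
    scale-permutes-units = ∼bag⇒↭ (unique∧set⇒bag
      (AllPairsₚ.map⁺ (AllPairs.map (_∘ scale-residue-injective) units-residues-distinct))
      (AllPairs.map (_∘ cong (_% m)) units-residues-distinct)
      (mk⇔ (λ z∈ → let _ , u∈ , z≡ = ∈-map⁻ (scale x) z∈ in subst (_∈ units) (sym z≡) (scale-preserves-units u∈)) units⊆map-scale))

  euler : ∀ {x} → Coprime x m → (x ^ totient) % m ≡ 1 % m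
  euler {x} x⊥m = invertible-cancelʳ m {x ^ totient} {1} (coprime⇒invertible m units-product-coprime) (begin
    (x ^ totient * product units) % m ≡⟨ product-map-scale x units ⟨
    product (map (scale x) units) % m ≡⟨ cong (_% m) (product-↭ (scale-permutes-units x⊥m)) ⟩
    product units % m                 ≡⟨ cong (_% m) (*-identityˡ (product units)) ⟨
    (1 * product units) % m           ∎)
    where
    open ≡-Reasoning
    units-product-coprime : Coprime (product units) m
    units-product-coprime = coprime-product m (tabulate (proj₂ ∘ ∈-units⁻))

IsExponent : (m : ℕ) .{{_ : NonZero m}} → ℕ → Set
IsExponent m e = ∀ {x} → Coprime x m → (x ^ e) % m ≡ 1 % m

isExponentᵇ⇔ : ∀ m e .{{_ : NonZero m}} → T (isExponentᵇ m e) ⇔ IsExponent m e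
isExponentᵇ⇔ m e = mk⇔ exponent exponent⁻¹
  where
  exponent : T (isExponentᵇ m e) → IsExponent m e
  exponent t {x} x⊥m = begin
    (x ^ e) % m       ≡⟨ %-cong-^ m e (m%n%n≡m%n x m) ⟨
    ((x % m) ^ e) % m ≡⟨ to (congᵇ⇔ _ 1 m) (to T-if-else-true (to (allBelow⇔ m _) t (x % m) (m%n<n x m))
                                              (from (coprimeᵇ⇔ _ m) (coprime-% m x⊥m))) ⟩
    1 % m             ∎
    where open ≡-Reasoning

  exponent⁻¹ : IsExponent m e → T (isExponentᵇ m e)
  exponent⁻¹ h = from (allBelow⇔ m _) (λ x _ → from T-if-else-true (λ t → from (congᵇ⇔ _ 1 m) (h (to (coprimeᵇ⇔ x m) t))))

coprime-divisor-^ : ∀ {i x} N {u} → Coprime i x → i ∣ x ^ N * u → i ∣ u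
coprime-divisor-^ {i} zero    {u} _   i∣u   = subst (i ∣_) (*-identityˡ u) i∣u
coprime-divisor-^ {i} {x} (suc N) {u} i⊥x i∣xxᴺu =
  coprime-divisor-^ N i⊥x (coprime-divisor i⊥x (subst (i ∣_) (*-assoc x (x ^ N) u) i∣xxᴺu))

coprime-cofactor : ∀ x c .{{_ : NonZero c}} → ∃₂ λ u N → Coprime u x × c ∣ x ^ N * u
coprime-cofactor x c = go c (<-wellFounded c)
  where
  go : ∀ c .{{_ : NonZero c}} → Acc _<_ c → ∃₂ λ u N → Coprime u x × c ∣ x ^ N * u
  go c (acc rec) with coprime? c x
  ... | yes c⊥x = c , 0 , c⊥x , ∣-reflexive (sym (*-identityˡ c))
  ... | no ¬c⊥x = peel (gcd[m,n]∣m c x) (gcd[m,n]∣n c x) (¬c⊥x ∘ gcd≡1⇒coprime)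
    where
    peel : ∀ {g} → g ∣ c → g ∣ x → g ≢ 1 → ∃₂ λ u N → Coprime u x × c ∣ x ^ N * u
    peel (divides zero c≡0) _ _ = contradiction c≡0 (≢-nonZero⁻¹ c)
    peel {zero} (divides q c≡q*0) _ _ = contradiction (trans c≡q*0 (*-zeroʳ q)) (≢-nonZero⁻¹ c)
    peel {1} _ _ g≢1 = contradiction refl g≢1
    peel {g@(suc (suc _))} (divides q@(suc _) c≡qg) g∣x _
      with u , N , u⊥x , q∣xᴺu ← go q (rec (subst (q <_) (sym c≡qg) (m<m*n q g (s≤s (s≤s z≤n))))) =
      u , suc N , u⊥x , subst₂ _∣_ (sym c≡qg) (trans (*-comm (x ^ N * u) x) (sym (*-assoc x (x ^ N) u)))
                                     (*-pres-∣ q∣xᴺu g∣x)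

-- y = x + d u, where c ∣ x ^ N * u and u ⊥ x.  A common divisor i of y and c is coprime to x
-- (a factor shared with x would divide d u and be coprime to d, so divide u), hence i ∣ u,
-- so i ∣ x and i = 1.
coprime-lift : ∀ {x d} c .{{_ : NonZero d}} .{{_ : NonZero c}} → Coprime x d →
               ∃ λ y → y % d ≡ x % d × Coprime y c
coprime-lift {x} {d} c x⊥d with u , N , u⊥x , c∣xᴺu ← coprime-cofactor x c =
  x + d * u , %-remove-+ʳ x (m∣m*n u) , y⊥c
  where
  y⊥c : Coprime (x + d * u) c
  y⊥c {i} (i∣y , i∣c) = i⊥x (∣-refl , i∣x)
    where
    i⊥x : Coprime i x
    i⊥x {j} (j∣i , j∣x) = u⊥x (coprime-divisor j⊥d (∣m+n∣m⇒∣n (∣-trans j∣i i∣y) j∣x) , j∣x)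
      where
      j⊥d : Coprime j d
      j⊥d (k∣j , k∣d) = x⊥d (∣-trans k∣j j∣x , k∣d)
    i∣x : i ∣ x
    i∣x = ∣m+n∣m⇒∣n (subst (i ∣_) (+-comm x (d * u)) i∣y)
                    (∣n⇒∣m*n d (coprime-divisor-^ N i⊥x (∣-trans i∣c c∣xᴺu)))

isExponent-∣ : ∀ {d c e} .{{_ : NonZero d}} .{{_ : NonZero c}} → d ∣ c → IsExponent c e → IsExponent d e
isExponent-∣ {d} {c} {e} d∣c c-exp {x} x⊥d with y , y≡x , y⊥c ← coprime-lift c x⊥d = begin
  (x ^ e) % d       ≡⟨ %-cong-^ d e y≡x ⟨
  (y ^ e) % d       ≡⟨ m∣n⇒o%n%m≡o%m d c (y ^ e) d∣c ⟨
  (y ^ e) % c % d   ≡⟨ cong (_% d) (c-exp y⊥c) ⟩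
  1 % c % d         ≡⟨ m∣n⇒o%n%m≡o%m d c 1 d∣c ⟩
  1 % d             ∎
  where open ≡-Reasoning

carmichael-firstHit : ∀ m .{{_ : NonZero m}} → FirstHit (isExponentᵇ m) 1 (totient m) (carmichael m)
carmichael-firstHit m = searchFrom-firstHit (isExponentᵇ m) 1 m (totient≥1 m) (s≤s (totient≤ m))
                                            (from (isExponentᵇ⇔ m (totient m)) (euler m))

carmichael-isExponent : ∀ m .{{_ : NonZero m}} → IsExponent m (carmichael m)
carmichael-isExponent m = to (isExponentᵇ⇔ m (carmichael m)) (FirstHit.hit (carmichael-firstHit m))

carmichael-positive : ∀ {m} → 1 ≤ m → 1 ≤ carmichael m
carmichael-positive {suc m} _ = FirstHit.start≤ (carmichael-firstHit (suc m))

carmichael< : ∀ {m} → 1 < m → carmichael m < m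
carmichael< {m@(suc _)} 1<m = ≤-<-trans (FirstHit.bounded (carmichael-firstHit m)) (totient< m 1<m)

carmichael-1 : carmichael 1 ≡ 1
carmichael-1 = refl

ord∣ : ∀ m a {e} .{{_ : NonZero m}} → Coprime a m → (a ^ e) % m ≡ 1 % m → ord m a ∣ e
ord∣ m a a⊥m = least-positive-∣ (λ j → (a ^ j) % m ≡ 1 % m) (ord m a)
  (λ 1≤j j<o aʲ≡1 → FirstHit.first hit 1≤j j<o (from (congᵇ⇔ _ 1 m) aʲ≡1))
  (λ {e} aᵉ≡1 → ^≡1⇒^[%]≡1 m a (ord m a) e (to (congᵇ⇔ _ 1 m) (FirstHit.hit hit)) aᵉ≡1)
  where
  hit : FirstHit (λ k → congᵇ (a ^ k) 1 m) 1 (totient m) (ord m a)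
  hit = searchFrom-firstHit _ 1 m (totient≥1 m) (s≤s (totient≤ m)) (from (congᵇ⇔ _ 1 m) (euler m a⊥m))
  instance
    ord≢0 : NonZero (ord m a)
    ord≢0 = >-nonZero (FirstHit.start≤ hit)

V-spec : ∀ a o → 1 ≤ o → 1 ≤ V a o × V a o ∣ o × Coprime (V a o) a
V-spec a o 1≤o =
  let 1≤v , t = largestUpTo-positive _ o 1≤o (from T-∧ (fromWitness (1∣ o) , from (coprimeᵇ⇔ 1 a) (1-coprimeTo a)))
      v∣o? , v⊥a? = to T-∧ t
  in 1≤v , toWitness v∣o? , to (coprimeᵇ⇔ _ a) v⊥a?

ord-V∣carmichael : ∀ a {o c} → o ∣ c → ord (V a o) a ∣ carmichael c
-- carmichael 0 = 0: the search defining it is empty.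
ord-V∣carmichael a {_}         {zero}      _   = _ ∣0
ord-V∣carmichael a {zero}      {c@(suc _)} 0∣c = contradiction (0∣⇒≡0 0∣c) (≢-nonZero⁻¹ c)
ord-V∣carmichael a {o@(suc _)} {c@(suc _)} o∣c =
  ord∣ (V a o) a a⊥v (isExponent-∣ {e = carmichael c} (∣-trans v∣o o∣c) (carmichael-isExponent c) a⊥v)
  where
  spec = V-spec a o z<s
  v∣o = proj₁ (proj₂ spec)
  a⊥v = Coprimality.sym (proj₂ (proj₂ spec))
  instance
    v≢0 : NonZero (V a o)
    v≢0 = >-nonZero (proj₁ spec)

ordIter∣carmichaelIter : ∀ n a k → ordIter k n a ∣ carmichaelIter k n
ordIter∣carmichaelIter n a zero    = ∣-refl
ordIter∣carmichaelIter n a (suc k) = ord-V∣carmichael a (ordIter∣carmichaelIter n a k)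

iter-fixed : ∀ f {x h n} → f x ≡ x → iter f h n ≡ x → ∀ {i} → h ≤ i → iter f i n ≡ x
iter-fixed f fx≡x fʰn≡x {zero}  z≤n  = fʰn≡x
iter-fixed f fx≡x fʰn≡x {suc i} h≤1+i with m≤n⇒m<n∨m≡n h≤1+i
... | inj₂ refl  = fʰn≡x
... | inj₁ h<1+i = trans (cong f (iter-fixed f fx≡x fʰn≡x (≤-pred h<1+i))) fx≡x

module Descent (f : ℕ → ℕ) (f-positive : ∀ {m} → 1 ≤ m → 1 ≤ f m) (f-1 : f 1 ≡ 1)
               (f-< : ∀ {m} → 1 < m → f m < m) where

  iter-positive : ∀ {n} → 1 ≤ n → ∀ k → 1 ≤ iter f k n
  iter-positive 1≤n zero    = 1≤n
  iter-positive 1≤n (suc k) = f-positive (iter-positive 1≤n k)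

  iter≡1⊎+≤ : ∀ {n} → 1 ≤ n → ∀ k → iter f k n ≡ 1 ⊎ iter f k n + k ≤ n
  iter≡1⊎+≤ {n} _   zero    = inj₂ (≤-reflexive (+-identityʳ n))
  iter≡1⊎+≤ {n} 1≤n (suc k) with iter f k n | iter-positive 1≤n k | iter≡1⊎+≤ 1≤n k
  ... | 1           | _ | _          = inj₁ f-1
  ... | suc (suc j) | _ | inj₂ x+k≤n = inj₂ (begin
    f (2 + j) + suc k   ≡⟨ +-suc (f (2 + j)) k ⟩
    suc (f (2 + j) + k) ≤⟨ +-monoˡ-≤ k (f-< (s≤s (s≤s z≤n))) ⟩
    2 + j + k           ≤⟨ x+k≤n ⟩
    n                   ∎)
    where open ≤-Reasoning

  iter-n≡1 : ∀ {n} → 1 ≤ n → iter f n n ≡ 1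
  iter-n≡1 {n} 1≤n with iter≡1⊎+≤ 1≤n n
  ... | inj₁ fⁿn≡1  = fⁿn≡1
  ... | inj₂ fⁿn+n≤n = contradiction (≤-trans (+-monoˡ-≤ n (iter-positive 1≤n n)) fⁿn+n≤n) (<-irrefl refl)

open Descent carmichael carmichael-positive carmichael-1 carmichael< using (iter-n≡1)

carmichaelIter-H≡1 : ∀ n → 1 ≤ n → carmichaelIter (H n) n ≡ 1
carmichaelIter-H≡1 n 1≤n = ≡ᵇ⇒≡ _ 1 (FirstHit.hit
  (searchFrom-firstHit (λ α → carmichaelIter α n ≡ᵇ 1) 0 (suc n) z≤n ≤-refl (≡⇒≡ᵇ _ 1 (iter-n≡1 1≤n))))

lcmUpTo-least : ∀ f k {x} → (∀ {i} → i ≤ k → f i ∣ x) → lcmUpTo f k ∣ x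
lcmUpTo-least f zero    f∣x = f∣x z≤n
lcmUpTo-least f (suc k) f∣x = lcm-least (lcmUpTo-least f k (f∣x ∘ m≤n⇒m≤1+n)) (f∣x ≤-refl)

∣lcmUpTo : ∀ f {k i} → i ≤ k → f i ∣ lcmUpTo f k
∣lcmUpTo f {zero}  z≤n  = ∣-refl
∣lcmUpTo f {suc k} i≤1+k with m≤n⇒m<n∨m≡n i≤1+k
... | inj₂ refl  = n∣lcm[m,n] (lcmUpTo f k) (f (suc k))
... | inj₁ i<1+k = ∣-trans (∣lcmUpTo f (≤-pred i<1+k)) (m∣lcm[m,n] (lcmUpTo f k) (f (suc k)))

lemma5p2 : (n a : ℕ) → 1 ≤ n → 1 ≤ a →
    ((k : ℕ) → ordIter k n a ∣ carmichaelIter k n) × (La a n ∣ L n)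
lemma5p2 n a 1≤n _ = ordIter∣carmichaelIter n a , lcmUpTo-least _ n ordIter∣L
  where
  ordIter∣L : ∀ {i} → i ≤ n → ordIter i n a ∣ L n
  ordIter∣L {i} _ with i ≤? H n
  ... | yes i≤H = ∣-trans (ordIter∣carmichaelIter n a i) (∣lcmUpTo (λ j → carmichaelIter j n) i≤H)
  ... | no  i≰H = ∣-trans (subst (ordIter i n a ∣_) λⁱn≡1 (ordIter∣carmichaelIter n a i)) (1∣ L n)
    where
    λⁱn≡1 : carmichaelIter i n ≡ 1
    λⁱn≡1 = iter-fixed carmichael carmichael-1 (carmichaelIter-H≡1 n 1≤n) (<⇒≤ (≰⇒> i≰H))
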